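{- Let $\mathbf M$ be a cyclic pointed residuated $\mathbf S$-bimodule with point $0$. The map $\gamma:S\times M\to S\times M$, $\gamma\langle a,x\rangle=\langle 0\backslash_r x,x\rangle$ $(=\langle x/_\ell 0,x\rangle)$, is an idempotent isotone map on $\mathbf S\ltimes\mathbf M$ which preserves all existing meets. Its restriction to $(\mathbf S\ltimes\mathbf M)_0$ is a closure operator on the poset $(\mathbf S\ltimes\mathbf M)_0$ which preserves all existing componentwise meets in $(\mathbf S\ltimes\mathbf M)_0$. Moreover, the image of $\gamma$ on $(\mathbf S\ltimes\mathbf M)_0$ equals the image of $\gamma$ on $\mathbf S\ltimes\mathbf M$.
   Context: A posemigroup is a poset with an isotone associative multiplication. $\mathbf S$ is a posemigroup, $\mathbf M=\langle M,\vee\rangle$ a join semilattice; elements of $S$ are $a,b$, of $M$ are $x,y$. A residuated $\mathbf S$-bimodule: isotone actions $a*x,x*a\in M$ with $(ab)*x=a*(b*x)$, $x*(ab)=(x*a)*b$, $(a*x)*b=a*(x*b)$, distributing over $\vee$, and maps $\backslash_\ell:S\times M\to M$, $/_\ell:M\times M\to S$, $\backslash_r:M\times M\to S$, $/_r:M\times S\to M$ with $x\le a\backslash_\ell y\iff a*x\le y\iff a\le y/_\ell x$ and $x\le y/_r a\iff x*a\le y\iff a\le x\backslash_r y$. Cyclic pointed: $0\in M$ with $a*0=0*a$ for all $a$. The Nagata product $\mathbf S\ltimes\mathbf M$: $S\times M$ with componentwise (product) order and $\langle a,x\rangle\circ\langle b,y\rangle=\langle ab,x*b\vee a*y\rangle$;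 the restricted Nagata product $(\mathbf S\ltimes\mathbf M)_0$ is its subset $\{\langle a,x\rangle:0*a\le x,a*0\le x\}$. A meet in $(\mathbf S\ltimes\mathbf M)_0$ is componentwise if it exists there and equals $\langle\bigwedge a_i,\bigwedge x_i\rangle$ with the component meets existing in $\mathbf S$ and $\mathbf M$. A closure operator on a poset is an isotone map $\gamma$ with $m\le\gamma m=\gamma\gamma m$. -}

module Defs where

open import Level using (Level; _⊔_) renaming (suc to lsuc)
open import Data.Product using (Σ; _×_; _,_; proj₁; proj₂)
open import Relation.Binary.PropositionalEquality using (_≡_)
open import Relation.Binary.Structures using (IsPartialOrder)
open import Relation.Binary.Lattice.Structures using (IsJoinSemilattice)
open import Function.Bundles using (_⇔_)

record Posemigroup (c ℓ : Level) : Set (lsuc (c ⊔ ℓ)) where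
  infixl 7 _·_
  infix 4 _≤_
  field
    Carrier        : Set c
    _≤_            : Carrier → Carrier → Set ℓ
    _·_            : Carrier → Carrier → Carrier
    isPartialOrder : IsPartialOrder _≡_ _≤_
    assoc          : ∀ a b c → (a · b) · c ≡ a · (b · c)
    ·-mono         : ∀ {a a′ b b′} → a ≤ a′ → b ≤ b′ → a · b ≤ a′ · b′

record JoinSL (c ℓ : Level) : Set (lsuc (c ⊔ ℓ)) where
  infixr 6 _∨_
  infix 4 _≤_
  field
    Carrier           : Set c
    _≤_               : Carrier → Carrier → Set ℓ
    _∨_               : Carrier → Carrier → Carrier
    isJoinSemilattice : IsJoinSemilattice _≡_ _≤_ _∨_

record ResBimodule {c₁ ℓ₁ c₂ ℓ₂ : Level}
         (S : Posemigroup c₁ ℓ₁) (M : JoinSL c₂ ℓ₂) : Set (c₁ ⊔ ℓ₁ ⊔ c₂ ⊔ ℓ₂) where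
  private
    module S = Posemigroup S
    module M = JoinSL M
  field
    _*ₗ_  : S.Carrier → M.Carrier → M.Carrier
    _*ᵣ_  : M.Carrier → S.Carrier → M.Carrier
    _∖ₗ_  : S.Carrier → M.Carrier → M.Carrier
    _/ₗ_  : M.Carrier → M.Carrier → S.Carrier
    _∖ᵣ_  : M.Carrier → M.Carrier → S.Carrier
    _/ᵣ_  : M.Carrier → S.Carrier → M.Carrier
    *ₗ-mono : ∀ {a b x y} → a S.≤ b → x M.≤ y → (a *ₗ x) M.≤ (b *ₗ y)
    *ᵣ-mono : ∀ {a b x y} → a S.≤ b → x M.≤ y → (x *ᵣ a) M.≤ (y *ᵣ b)
    assocₗ  : ∀ a b x → (a S.· b) *ₗ x ≡ a *ₗ (b *ₗ x)
    assocᵣ  : ∀ x a b → x *ᵣ (a S.· b) ≡ (x *ᵣ a) *ᵣ b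
    assocₘ  : ∀ a x b → (a *ₗ x) *ᵣ b ≡ a *ₗ (x *ᵣ b)
    distribₗ : ∀ a x y → a *ₗ (x M.∨ y) ≡ (a *ₗ x) M.∨ (a *ₗ y)
    distribᵣ : ∀ x y a → (x M.∨ y) *ᵣ a ≡ (x *ᵣ a) M.∨ (y *ᵣ a)
    resₗ₁ : ∀ a x y → (x M.≤ (a ∖ₗ y)) ⇔ ((a *ₗ x) M.≤ y)
    resₗ₂ : ∀ a x y → ((a *ₗ x) M.≤ y) ⇔ (a S.≤ (y /ₗ x))
    resᵣ₁ : ∀ a x y → (x M.≤ (y /ᵣ a)) ⇔ ((x *ᵣ a) M.≤ y)
    resᵣ₂ : ∀ a x y → ((x *ᵣ a) M.≤ y) ⇔ (a S.≤ (x ∖ᵣ y))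

record CyclicPoint {c₁ ℓ₁ c₂ ℓ₂ : Level} {S : Posemigroup c₁ ℓ₁} {M : JoinSL c₂ ℓ₂}
         (B : ResBimodule S M) : Set (c₁ ⊔ c₂) where
  open ResBimodule B
  field
    point  : JoinSL.Carrier M
    cyclic : ∀ a → a *ₗ point ≡ point *ᵣ a

module Nagata {c₁ ℓ₁ c₂ ℓ₂ : Level} {S : Posemigroup c₁ ℓ₁} {M : JoinSL c₂ ℓ₂}
         (B : ResBimodule S M) (P : CyclicPoint B) where
  private
    module S = Posemigroup S
    module M = JoinSL M
  open ResBimodule B
  open CyclicPoint P

  -- Underlying set of S ⋉ M (and of (S ⋉ M)₀) with the componentwise order.
  NP : Set (c₁ ⊔ c₂)
  NP = S.Carrier × M.Carrier

  infix 4 _⊑_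
  _⊑_ : NP → NP → Set (ℓ₁ ⊔ ℓ₂)
  (a , x) ⊑ (b , y) = (a S.≤ b) × (x M.≤ y)

  -- Nagata multiplication (not needed in the statement, recorded for completeness).
  _∘ₙ_ : NP → NP → NP
  (a , x) ∘ₙ (b , y) = (a S.· b , (x *ᵣ b) M.∨ (a *ₗ y))

  In₀ : NP → Set ℓ₂
  In₀ (a , x) = ((point *ᵣ a) M.≤ x) × ((a *ₗ point) M.≤ x)

  γ : NP → NP
  γ (a , x) = (point ∖ᵣ x , x)

  -- Generic greatest-lower-bound of a family in a preorder restricted to a predicate Q
  -- (the ambient "poset" is {p | Q p} with the induced order).
module _ {a ℓ q : Level} {A : Set a} (_≤_ : A → A → Set ℓ) (Q : A → Set q) where
  IsMeetIn : ∀ {ι} {I : Set ι} → (I → A) → A → Set (a ⊔ ℓ ⊔ q ⊔ ι)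
  IsMeetIn {I = I} f m =
    Q m × (∀ i → m ≤ f i) × (∀ p → Q p → (∀ i → p ≤ f i) → p ≤ m)

{-# OPTIONS --safe #-}
module Submission where

open import Defs
open import Level using (Level)
open import Data.Unit using (⊤; tt)
open import Data.Product using (Σ; _×_; _,_; proj₁; proj₂)
open import Data.Product.Relation.Binary.Pointwise.NonDependent using (Pointwise)
open import Function.Base using (_∘_)
open import Function.Bundles using (_⇔_; mk⇔; Equivalence)
open import Relation.Binary.PropositionalEquality using (_≡_; refl; subst; sym)
open import Relation.Binary.Structures using (IsPartialOrder)
open import Relation.Binary.Lattice.Structures using (IsJoinSemilattice)

-- γ pairs the right adjoint 0 ∖ᵣ_ of 0 *ᵣ_ with the identity, so it
-- is isotone, idempotent and preserves meets because right adjoints do.  The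
-- counit 0 * (0 ∖ᵣ x) ≤ x, read on both sides of 0 via cyclicity, says that every
-- value of γ lies in (S ⋉ M)₀; this gives the closure property on (S ⋉ M)₀ and the
-- equality of the two images.

module _ {a b ℓ₁ ℓ₂ : Level} {A : Set a} {B : Set b}
         (_≤₁_ : A → A → Set ℓ₁) (_≤₂_ : B → B → Set ℓ₂) where

  Pointwise-IsMeetIn : ∀ {ι} {I : Set ι} {f : I → A × B} {m₁ m₂} →
                       IsMeetIn _≤₁_ (λ _ → ⊤) (proj₁ ∘ f) m₁ →
                       IsMeetIn _≤₂_ (λ _ → ⊤) (proj₂ ∘ f) m₂ →
                       IsMeetIn (Pointwise _≤₁_ _≤₂_) (λ _ → ⊤) f (m₁ , m₂)
  Pointwise-IsMeetIn (_ , lb₁ , glb₁) (_ , lb₂ , glb₂) =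
      tt
    , (λ i → lb₁ i , lb₂ i)
    , λ p _ p≤f → glb₁ (proj₁ p) tt (proj₁ ∘ p≤f) , glb₂ (proj₂ p) tt (proj₂ ∘ p≤f)

  proj₂-IsMeetIn : ∀ {ι} {I : Set ι} {f : I → A × B} {m₁ m₂} →
                   IsMeetIn (Pointwise _≤₁_ _≤₂_) (λ _ → ⊤) f (m₁ , m₂) →
                   IsMeetIn _≤₂_ (λ _ → ⊤) (proj₂ ∘ f) m₂
  proj₂-IsMeetIn (_ , lb , glb) =
      tt
    , proj₂ ∘ lb
    , λ y _ y≤f → proj₂ (glb (_ , y) tt (λ i → proj₁ (lb i) , y≤f i))

module _ {a ℓ q : Level} {A : Set a} {_≤_ : A → A → Set ℓ} {Q : A → Set q} where

  IsMeetIn-restrict : ∀ {ι} {I : Set ι} {f : I → A} {m} → Q m →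
                      IsMeetIn _≤_ (λ _ → ⊤) f m → IsMeetIn _≤_ Q f m
  IsMeetIn-restrict Qm (_ , lb , glb) = Qm , lb , λ p _ → glb p tt

module Residuation {c₁ ℓ₁ c₂ ℓ₂ : Level} {S : Posemigroup c₁ ℓ₁} {M : JoinSL c₂ ℓ₂}
                   (B : ResBimodule S M) where
  private
    module S = Posemigroup S
    module M = JoinSL M
    module S≤ = IsPartialOrder S.isPartialOrder
    module M≤ = IsPartialOrder (IsJoinSemilattice.isPartialOrder M.isJoinSemilattice)
  open ResBimodule B
  open Equivalence using (to; from)

  *ᵣ-∖ᵣ-≤ : ∀ x y → (x *ᵣ (x ∖ᵣ y)) M.≤ y
  *ᵣ-∖ᵣ-≤ x y = from (resᵣ₂ (x ∖ᵣ y) x y) S≤.refl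

  /ₗ-*ₗ-≤ : ∀ x y → ((y /ₗ x) *ₗ x) M.≤ y
  /ₗ-*ₗ-≤ x y = from (resₗ₂ (y /ₗ x) x y) S≤.refl

  ∖ᵣ-monoʳ : ∀ z {x y} → x M.≤ y → (z ∖ᵣ x) S.≤ (z ∖ᵣ y)
  ∖ᵣ-monoʳ z {x} {y} x≤y = to (resᵣ₂ (z ∖ᵣ x) z y) (M≤.trans (*ᵣ-∖ᵣ-≤ z x) x≤y)

  ∖ᵣ-preserves-meets : ∀ z {ι} {I : Set ι} {g : I → M.Carrier} {m} →
                       IsMeetIn M._≤_ (λ _ → ⊤) g m →
                       IsMeetIn S._≤_ (λ _ → ⊤) ((z ∖ᵣ_) ∘ g) (z ∖ᵣ m)
  ∖ᵣ-preserves-meets z (_ , lb , glb) =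
      tt
    , (λ i → ∖ᵣ-monoʳ z (lb i))
    , λ b _ b≤ → to (resᵣ₂ b z _)
                    (glb (z *ᵣ b) tt (λ i → from (resᵣ₂ b z _) (b≤ i)))

  module _ (P : CyclicPoint B) where
    open CyclicPoint P

    point∖ᵣ≡/ₗpoint : ∀ x → point ∖ᵣ x ≡ x /ₗ point
    point∖ᵣ≡/ₗpoint x = S≤.antisym
      (to (resₗ₂ _ point x) (subst (M._≤ x) (sym (cyclic _)) (*ᵣ-∖ᵣ-≤ point x)))
      (to (resᵣ₂ _ point x) (subst (M._≤ x) (cyclic _) (/ₗ-*ₗ-≤ point x)))

module NagataClosure {c₁ ℓ₁ c₂ ℓ₂ : Level} {S : Posemigroup c₁ ℓ₁} {M : JoinSL c₂ ℓ₂}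
                     (B : ResBimodule S M) (P : CyclicPoint B) where
  private
    module S = Posemigroup S
    module M = JoinSL M
    module M≤ = IsPartialOrder (IsJoinSemilattice.isPartialOrder M.isJoinSemilattice)
  open Nagata B P
  open ResBimodule B
  open CyclicPoint P
  open Residuation B
  open Equivalence using (to)

  γ-idempotent : ∀ p → γ (γ p) ≡ γ p
  γ-idempotent _ = refl

  γ-mono : ∀ p q → p ⊑ q → γ p ⊑ γ q
  γ-mono _ _ (_ , x≤y) = ∖ᵣ-monoʳ point x≤y , x≤y

  γ-In₀ : ∀ p → In₀ (γ p)
  γ-In₀ (_ , x) = *ᵣ-∖ᵣ-≤ point x , subst (M._≤ x) (sym (cyclic _)) (*ᵣ-∖ᵣ-≤ point x)

  γ-extensive-In₀ : ∀ p → In₀ p → p ⊑ γ p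
  γ-extensive-In₀ (a , x) (0a≤x , _) = to (resᵣ₂ a point x) 0a≤x , M≤.refl

  γ-meet-of-proj₂ : ∀ {ι} {I : Set ι} {f : I → NP} a {x} →
                    IsMeetIn M._≤_ (λ _ → ⊤) (proj₂ ∘ f) x →
                    IsMeetIn _⊑_ (λ _ → ⊤) (γ ∘ f) (γ (a , x))
  γ-meet-of-proj₂ _ meet = Pointwise-IsMeetIn S._≤_ M._≤_ (∖ᵣ-preserves-meets point meet) meet

  γ-preserves-meets : ∀ {ι} (I : Set ι) (f : I → NP) m →
                      IsMeetIn _⊑_ (λ _ → ⊤) f m →
                      IsMeetIn _⊑_ (λ _ → ⊤) (γ ∘ f) (γ m)
  γ-preserves-meets _ f (a , _) meet = γ-meet-of-proj₂ {f = f} a (proj₂-IsMeetIn S._≤_ M._≤_ meet)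

  γ-preserves-componentwise-meets :
    ∀ {ι} (I : Set ι) (f : I → NP) a x →
    (∀ i → In₀ (f i)) →
    IsMeetIn _⊑_ In₀ f (a , x) →
    IsMeetIn S._≤_ (λ _ → ⊤) (proj₁ ∘ f) a →
    IsMeetIn M._≤_ (λ _ → ⊤) (proj₂ ∘ f) x →
    IsMeetIn _⊑_ In₀ (γ ∘ f) (γ (a , x))
  γ-preserves-componentwise-meets _ f a x _ _ _ meetₓ =
    IsMeetIn-restrict {_≤_ = _⊑_} (γ-In₀ (a , x)) (γ-meet-of-proj₂ {f = f} a meetₓ)

  image-γ-In₀⇔image-γ : ∀ q → (Σ NP (λ p → In₀ p × γ p ≡ q)) ⇔ (Σ NP (λ p → γ p ≡ q))
  image-γ-In₀⇔image-γ q =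
    mk⇔ (λ (p , _ , γp≡q) → p , γp≡q) (λ (p , γp≡q) → γ p , γ-In₀ p , γp≡q)

mainTheorem8 : ∀ {c₁ ℓ₁ c₂ ℓ₂ ι : Level} {S : Posemigroup c₁ ℓ₁} {M : JoinSL c₂ ℓ₂}
    (B : ResBimodule S M) (P : CyclicPoint B) →
    let open Nagata B P
        module S = Posemigroup S
        module M = JoinSL M
        open ResBimodule B
        open CyclicPoint P
    in
    -- 0 \r x = x /ℓ 0
    (∀ x → point ∖ᵣ x ≡ x /ₗ point)
    -- γ is idempotent and isotone on S ⋉ M
    × (∀ p → γ (γ p) ≡ γ p)
    × (∀ p q → p ⊑ q → γ p ⊑ γ q)
    -- γ preserves all existing meets in S ⋉ M
    × (∀ (I : Set ι) (f : I → NP) (m : NP) →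
         IsMeetIn _⊑_ (λ _ → ⊤) f m → IsMeetIn _⊑_ (λ _ → ⊤) (γ ∘ f) (γ m))
    -- the restriction of γ to (S ⋉ M)₀ is a closure operator on (S ⋉ M)₀
    × (∀ p → In₀ p → In₀ (γ p))
    × (∀ p → In₀ p → p ⊑ γ p)
    -- γ restricted to (S ⋉ M)₀ preserves all existing componentwise meets in (S ⋉ M)₀
    × (∀ (I : Set ι) (f : I → NP) (a : S.Carrier) (x : M.Carrier) →
         (∀ i → In₀ (f i)) →
         IsMeetIn _⊑_ In₀ f (a , x) →
         IsMeetIn S._≤_ (λ _ → ⊤) (proj₁ ∘ f) a →
         IsMeetIn M._≤_ (λ _ → ⊤) (proj₂ ∘ f) x →
         IsMeetIn _⊑_ In₀ (γ ∘ f) (γ (a , x)))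
    -- image of γ on (S ⋉ M)₀ equals image of γ on S ⋉ M
    × (∀ q → (Σ NP (λ p → In₀ p × γ p ≡ q)) ⇔ (Σ NP (λ p → γ p ≡ q)))
mainTheorem8 B P =
    point∖ᵣ≡/ₗpoint P
  , γ-idempotent
  , γ-mono
  , γ-preserves-meets
  , (λ p _ → γ-In₀ p)
  , γ-extensive-In₀
  , γ-preserves-componentwise-meets
  , image-γ-In₀⇔image-γ
  where
  open Residuation B using (point∖ᵣ≡/ₗpoint)
  open NagataClosure B P
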